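{- Let $X$, GreedyArb, $j,k,P$ and the notions hidden/exposed be as in the context. Let $p\in P$ be hidden at time $t$, and suppose $t'\ge t$ is such that $p$ is hidden at every time $s$ with $t\le s\le t'$ and exposed at time $t'+1$. Let $q$ be the point of $X$ with $q.y=t'$ (the point processed by GreedyArb at time $t'$). Then $q\in P$.
   Context: Let $n\ge1$ and $X=\{p_1,\dots,p_n\}\subset\mathbb{Z}^2$ with $p_i=(i,t_i)$, where $(t_1,\dots,t_n)$ is a permutation of $\{1,\dots,n\}$; $a.x,a.y$ denote the coordinates of a point $a$. For points $a,b$ not on a common horizontal or vertical line, $\Box ab$ is the closed axis-parallel rectangle with opposite corners $a,b$. GreedyArb: for $t=1,\dots,n$ in order, let $p$ be the point of $X$ with $p.y=t$ and let $Z_t$ be the set of points of $X$ with $y$-coordinate $<t$ together with all points added at earlier steps; add $M_p=\{(q.x,t): q\in Z_t,\ q.x\ne p.x,\ \Box pq\text{ contains no point of }Z_t\cup\{p\}\text{ other than }p,q\}$. Let $Y=\bigcup_{p\in X}M_p$. Fix integers $j,k\ge1$ with $j+2k-1\le n$. Let $P=\{p_j,\dots,p_{j+k-1}\}$ and $R_P=\{(x,y): j-\tfrac12<x<j+k-\tfrac12\}$. For $p\in P$ and an integer $t>p.y$, let $T^p_{<t}$ be the set of points of $X\cup Y$ on the line $x=p.x$ with $y$-coordinate $<t$, and let $r$ be the point of $T^p_{<t}$ with largest $y$-coordinate. The point $p$ is hidden at time $t$ if there exist points of $X\cup Y$ in $R_P$ on the line $y=r.y$, one with $x$-coordinate $<r.x$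 and one with $x$-coordinate $>r.x$; otherwise $p$ is exposed at time $t$. -}

module Defs where

open import Data.Nat using (ℕ; zero; suc; _+_; _∸_; _≤_; _<_; _⊓_; _⊔_)
open import Data.Product using (Σ; ∃; ∃-syntax; _×_; _,_; proj₁; proj₂)
open import Data.Sum using (_⊎_)
open import Data.Empty using (⊥)
open import Relation.Nullary using (¬_)
open import Relation.Binary.PropositionalEquality using (_≡_; _≢_)

-- All relevant points have coordinates in {1,…,n}, so we use ℕ × ℕ.
Point : Set
Point = ℕ × ℕ

xc : Point → ℕ
xc = proj₁

yc : Point → ℕ
yc = proj₂

IsPerm : ℕ → (ℕ → ℕ) → Set
IsPerm n τ =
  (∀ i → 1 ≤ i → i ≤ n → 1 ≤ τ i × τ i ≤ n) ×
  (∀ i i' → 1 ≤ i → i ≤ n → 1 ≤ i' → i' ≤ n → τ i ≡ τ i' → i ≡ i')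

InX : ℕ → (ℕ → ℕ) → Point → Set
InX n τ a = ∃[ i ] (1 ≤ i × i ≤ n × a ≡ (i , τ i))

InBox : Point → Point → Point → Set
InBox a b c =
  (xc a ⊓ xc b ≤ xc c × xc c ≤ xc a ⊔ xc b) ×
  (yc a ⊓ yc b ≤ yc c × yc c ≤ yc a ⊔ yc b)

-- Points added at step t of GreedyArb, given (as a predicate) the set Z_t.
Added : ℕ → (ℕ → ℕ) → ℕ → (Point → Set) → Point → Set
Added n τ t Zt a =
  Σ Point λ p → InX n τ p × yc p ≡ t ×
  Σ Point λ q → Zt q × xc q ≢ xc p × a ≡ (xc q , t) ×
  (∀ c → (Zt c ⊎ c ≡ p) → InBox p q c → c ≡ p ⊎ c ≡ q)

Z : ℕ → (ℕ → ℕ) → ℕ → Point → Set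
Z n τ zero a = ⊥
Z n τ (suc t) a =
  Z n τ t a ⊎ (InX n τ a × yc a ≡ t) ⊎ Added n τ t (Z n τ t) a

InY : ℕ → (ℕ → ℕ) → Point → Set
InY n τ a = ∃[ t ] Added n τ t (Z n τ t) a

InXY : ℕ → (ℕ → ℕ) → Point → Set
InXY n τ a = InX n τ a ⊎ InY n τ a

InP : ℕ → (ℕ → ℕ) → ℕ → ℕ → Point → Set
InP n τ j k a = InX n τ a × j ≤ xc a × xc a < j + k

-- integer points of the open strip R_P : j - 1/2 < x < j + k - 1/2
InRP : ℕ → ℕ → Point → Set
InRP j k a = j ≤ xc a × xc a < j + k

-- p is hidden at time t (r is the top point of T^p_{<t})
Hidden : ℕ → (ℕ → ℕ) → ℕ → ℕ → Point → ℕ → Set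
Hidden n τ j k p t =
  Σ Point λ r → InXY n τ r × xc r ≡ xc p × yc r < t ×
  (∀ r' → InXY n τ r' → xc r' ≡ xc p → yc r' < t → yc r' ≤ yc r) ×
  (Σ Point λ a → InXY n τ a × InRP j k a × yc a ≡ yc r × xc a < xc r) ×
  (Σ Point λ b → InXY n τ b × InRP j k b × yc b ≡ yc r × xc r < xc b)

Exposed : ℕ → (ℕ → ℕ) → ℕ → ℕ → Point → ℕ → Set
Exposed n τ j k p t = ¬ Hidden n τ j k p t

-- Let r be the top point of column p.x below row t', flanked in the strip by a and b.
-- If q were outside the strip, say left of it, then GreedyArb adds at time t' no point
-- to column p.x: the only candidate (p.x, t') comes from a point z of that column
-- below r (p itself lies lower), and the box spanned by q and z contains a.
-- Hence r stays the top point at time t'+1 with the same neighbours, and p is still hidden.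
module Submission where

open import Defs
open import Data.Nat using (ℕ; suc; _+_; _*_; _∸_; _≤_; _<_; _⊓_; _⊔_; _≤?_; _<?_)
open import Data.Nat.Properties
open import Data.Product using (_×_; _,_; Σ)
open import Data.Sum using (_⊎_; inj₁; inj₂)
open import Data.Empty using (⊥-elim)
open import Relation.Nullary using (¬_; yes; no)
open import Relation.Binary.PropositionalEquality

Between : ℕ → ℕ → ℕ → Set
Between x y v = x ⊓ y ≤ v × v ≤ x ⊔ y

≤≤⇒Between : ∀ {x y v} → x ≤ v → v ≤ y → Between x y v
≤≤⇒Between {x} {y} x≤v v≤y = ≤-trans (m⊓n≤m x y) x≤v , ≤-trans v≤y (m≤n⊔m x y)

≥≥⇒Between : ∀ {x y v} → y ≤ v → v ≤ x → Between x y v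
≥≥⇒Between {x} {y} y≤v v≤x = ≤-trans (m⊓n≤n x y) y≤v , ≤-trans v≤x (m≤m⊔n x y)

Outside : ℕ → ℕ → ℕ → Set
Outside j k x = x < j ⊎ j + k ≤ x

inside-or-outside : ∀ j k x → (j ≤ x × x < j + k) ⊎ Outside j k x
inside-or-outside j k x with j ≤? x | x <? j + k
... | yes j≤x | yes x<j+k = inj₁ (j≤x , x<j+k)
... | no j≰x  | _         = inj₂ (inj₁ (≰⇒> j≰x))
... | _       | no x≮j+k  = inj₂ (inj₂ (≮⇒≥ x≮j+k))

module _ {n : ℕ} {τ : ℕ → ℕ} where

  InX-column-unique : ∀ {a b} → InX n τ a → InX n τ b → xc a ≡ xc b → a ≡ b
  InX-column-unique (i , _ , _ , refl) (.i , _ , _ , refl) refl = refl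

  InX-row-unique : IsPerm n τ → ∀ {a b} → InX n τ a → InX n τ b → yc a ≡ yc b → a ≡ b
  InX-row-unique (_ , τ-injective) (i , 1≤i , i≤n , refl) (i' , 1≤i' , i'≤n , refl) τi≡τi'
    rewrite τ-injective i i' 1≤i i≤n 1≤i' i'≤n τi≡τi' = refl

  Added⇒y≡ : ∀ {t Zt a} → Added n τ t Zt a → yc a ≡ t
  Added⇒y≡ (_ , _ , _ , _ , _ , _ , refl , _) = refl

  Z⇒y< : ∀ t {a} → Z n τ t a → yc a < t
  Z⇒y< (suc t) (inj₁ a∈Z)           = m<n⇒m<1+n (Z⇒y< t a∈Z)
  Z⇒y< (suc t) (inj₂ (inj₁ (_ , y≡))) = ≤-reflexive (cong suc y≡)
  Z⇒y< (suc t) (inj₂ (inj₂ added))   = ≤-reflexive (cong suc (Added⇒y≡ added))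

  Z⇒InXY : ∀ t {a} → Z n τ t a → InXY n τ a
  Z⇒InXY (suc t) (inj₁ a∈Z)         = Z⇒InXY t a∈Z
  Z⇒InXY (suc t) (inj₂ (inj₁ (x , _))) = inj₁ x
  Z⇒InXY (suc t) (inj₂ (inj₂ added)) = inj₂ (t , added)

  InXY⇒Z : ∀ t {a} → InXY n τ a → yc a < t → Z n τ t a
  InXY⇒Z (suc t) a∈XY y<1+t with m<1+n⇒m<n∨m≡n y<1+t
  ... | inj₁ y<t = inj₁ (InXY⇒Z t a∈XY y<t)
  InXY⇒Z (suc t) (inj₁ a∈X) _ | inj₂ y≡t = inj₂ (inj₁ (a∈X , y≡t))
  InXY⇒Z (suc t) {a} (inj₂ (u , added)) _ | inj₂ y≡t =
    inj₂ (inj₂ (subst (λ v → Added n τ v (Z n τ v) a) (trans (sym (Added⇒y≡ added)) y≡t) added))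

  empty-box-excludes : ∀ {u p₀ z c} → yc p₀ ≡ u →
    (∀ c → (Z n τ u c ⊎ c ≡ p₀) → InBox p₀ z c → c ≡ p₀ ⊎ c ≡ z) →
    InXY n τ c → yc c < u → xc c ≢ xc z → ¬ InBox p₀ z c
  empty-box-excludes {u} {c = c} y₀≡u empty c∈XY y<u x≢ box
    with empty c (inj₁ (InXY⇒Z u c∈XY y<u)) box
  ... | inj₁ refl = <-irrefl y₀≡u y<u
  ... | inj₂ refl = x≢ refl

  neighbour-towards : ∀ {j k r} x → Outside j k x →
    (Σ Point λ a → InXY n τ a × InRP j k a × yc a ≡ yc r × xc a < xc r) →
    (Σ Point λ b → InXY n τ b × InRP j k b × yc b ≡ yc r × xc r < xc b) →
    Σ Point λ c → InXY n τ c × yc c ≡ yc r × xc c ≢ xc r × Between x (xc r) (xc c)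
  neighbour-towards x (inj₁ x<j) (a , a∈XY , (j≤a , _) , ya≡ , a<r) _ =
    a , a∈XY , ya≡ , <⇒≢ a<r , ≤≤⇒Between (<⇒≤ (<-≤-trans x<j j≤a)) (<⇒≤ a<r)
  neighbour-towards x (inj₂ j+k≤x) _ (b , b∈XY , (_ , b<j+k) , yb≡ , r<b) =
    b , b∈XY , yb≡ , ≢-sym (<⇒≢ r<b) , ≥≥⇒Between (<⇒≤ r<b) (<⇒≤ (<-≤-trans b<j+k j+k≤x))

  module _ {j k : ℕ} (perm : IsPerm n τ) {p : Point} (p∈X : InX n τ p) {t : ℕ} (yp<t : yc p < t)
           {q : Point} (q∈X : InX n τ q) (yq≡t : yc q ≡ t) (q-outside : Outside j k (xc q))
           {r : Point} (xr≡xp : xc r ≡ xc p) (yr<t : yc r < t)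
           (r-top : ∀ r' → InXY n τ r' → xc r' ≡ xc p → yc r' < t → yc r' ≤ yc r)
           (left : Σ Point λ a → InXY n τ a × InRP j k a × yc a ≡ yc r × xc a < xc r)
           (right : Σ Point λ b → InXY n τ b × InRP j k b × yc b ≡ yc r × xc r < xc b) where

    column-free-at-t : ∀ r' → InXY n τ r' → xc r' ≡ xc p → yc r' ≢ t
    column-free-at-t r' (inj₁ r'∈X) x≡ y≡ =
      <-irrefl (trans (sym (cong yc (InX-column-unique r'∈X p∈X x≡))) y≡) yp<t
    column-free-at-t r' (inj₂ (u , p₀ , p₀∈X , yp₀≡u , z , z∈Z , _ , refl , empty)) xz≡xp refl
      with InX-row-unique perm p₀∈X q∈X (trans yp₀≡u (sym yq≡t))
         | neighbour-towards (xc q) q-outside left right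
    ... | refl | c , c∈XY , yc≡yr , xc≢xr , between =
      empty-box-excludes yp₀≡u empty c∈XY yc<t (λ x≡ → xc≢xr (trans x≡ xz≡xr))
        (subst (λ x → Between (xc q) x (xc c)) (sym xz≡xr) between ,
         ≥≥⇒Between yz≤yc (<⇒≤ (subst (yc c <_) (sym yq≡t) yc<t)))
      where
      xz≡xr : xc z ≡ xc r
      xz≡xr = trans xz≡xp (sym xr≡xp)
      yc<t : yc c < t
      yc<t = subst (_< t) (sym yc≡yr) yr<t
      yz≤yc : yc z ≤ yc c
      yz≤yc = subst (yc z ≤_) (sym yc≡yr) (r-top z (Z⇒InXY t z∈Z) xz≡xp (Z⇒y< t z∈Z))

    top-persists : ∀ r' → InXY n τ r' → xc r' ≡ xc p → yc r' < suc t → yc r' ≤ yc r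
    top-persists r' r'∈XY x≡ y<1+t with m<1+n⇒m<n∨m≡n y<1+t
    ... | inj₁ y<t = r-top r' r'∈XY x≡ y<t
    ... | inj₂ y≡t = ⊥-elim (column-free-at-t r' r'∈XY x≡ y≡t)

  hidden-persists : ∀ {j k} → IsPerm n τ → ∀ {p} → InX n τ p → ∀ {t} → yc p < t →
    ∀ {q} → InX n τ q → yc q ≡ t → Outside j k (xc q) →
    Hidden n τ j k p t → Hidden n τ j k p (suc t)
  hidden-persists perm p∈X yp<t q∈X yq≡t q-outside (r , r∈XY , xr≡xp , yr<t , r-top , left , right) =
    r , r∈XY , xr≡xp , m<n⇒m<1+n yr<t ,
    top-persists perm p∈X yp<t q∈X yq≡t q-outside xr≡xp yr<t r-top left right ,
    left , right

lemma3 : (n : ℕ) (τ : ℕ → ℕ) → 1 ≤ n → IsPerm n τ →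
    (j k : ℕ) → 1 ≤ j → 1 ≤ k → j + 2 * k ∸ 1 ≤ n →
    (p : Point) → InP n τ j k p →
    (t t' : ℕ) → yc p < t → t ≤ t' →
    (∀ s → t ≤ s → s ≤ t' → Hidden n τ j k p s) →
    Exposed n τ j k p (suc t') →
    (q : Point) → InX n τ q → yc q ≡ t' →
    InP n τ j k q
lemma3 n τ _ perm j k _ _ _ p (p∈X , _) t t' yp<t t≤t' hidden exposed q q∈X yq≡t'
  with inside-or-outside j k (xc q)
... | inj₁ q-inside  = q∈X , q-inside
... | inj₂ q-outside =
  ⊥-elim (exposed (hidden-persists perm p∈X (<-≤-trans yp<t t≤t') q∈X yq≡t' q-outside
                     (hidden t' t≤t' ≤-refl)))
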